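{- Let $R\subseteq[n-1]$ and let $\pi\in S_n^R$ be $R$-312-avoiding, with $B_h=\{\pi_1,\dots,\pi_{q_h}\}$. Define $\sigma\in S_n$ by: $\sigma_i=\pi_i$ for $i\in(0,q_1]$; for each $h\in[r]$, with $m=\max B_h$ and $s$ the number of elements of $B_{h+1}\setminus B_h$ less than $m$, list these $s$ elements in decreasing order in positions $(q_h,q_h+s]$, and list the remaining $p_{h+1}-s$ elements of $B_{h+1}\setminus B_h$ in increasing order in positions $(q_h+s,q_{h+1}]$. Then (i) $\sigma$ is 312-avoiding and its $R$-projection $\bar\sigma$ equals $\pi$; (ii) $\sigma$ is the unique permutation of minimum length among all 312-avoiding $\sigma'\in S_n$ with $\bar{\sigma'}=\pi$.
   Context: Fix $n\ge1$; $[m]=\{1,\dots,m\}$, $(a,b]=\{a+1,\dots,b\}$. Write $R=\{q_1<\cdots<q_r\}$, $q_0=0$, $q_{r+1}=n$, $p_h=q_h-q_{h-1}$; the $h$-th carrel is $(q_{h-1},q_h]$. Permutations of $[n]$ are written $\sigma=(\sigma_1,\dots,\sigma_n)$. $\sigma$ is 312-avoiding if there are no $a<b<c$ with $\sigma_b<\sigma_c<\sigma_a$. The length of $\sigma$ is its number of inversions $\#\{(i,j):i<j,\sigma_i>\sigma_j\}$. $S_n^R$ is the set of permutations strictly increasing on each carrel ($R$-permutations). $\pi\in S_n^R$ is $R$-312-containing if there exist $h\in[r-1]$ and $a\le q_h<b\le q_{h+1}<c\le n$ with $\pi_b<\pi_c<\pi_a$, and $R$-312-avoiding otherwise. The $R$-projection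 $\bar\sigma\in S_n^R$ of $\sigma\in S_n$ is obtained by sorting the entries within each carrel into increasing order. -}

module Defs where

open import Data.Nat using (ℕ; zero; suc; _+_; _∸_; _≤_; _<_; _⊔_; _<?_)
open import Data.Nat.Properties using (≤-decTotalOrder)
open import Data.List using (List; []; _∷_; _++_; take; drop; filter; reverse; concat; map; length; upTo; sum)
open import Data.List.Membership.DecPropositional (Data.Nat._≟_) using (_∉?_)
open import Data.List.Relation.Unary.All using (All)
open import Data.List.Relation.Unary.Linked using (Linked)
open import Data.List.Relation.Binary.Permutation.Propositional using (_↭_)
open import Data.Product using (Σ; _×_; ∃)
open import Relation.Nullary using (¬_)
open import Relation.Nullary.Decidable using (¬?)
open import Data.List.Sort.InsertionSort ≤-decTotalOrder using (sort)

-- Conventions: a permutation of [n] is a list σ = (σ₁,…,σₙ) of naturals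
-- which is a rearrangement of (1,…,n).  Positions are 1-indexed.

-- 1-indexed entry σ_i (default 0 outside range; never used there).
at : List ℕ → ℕ → ℕ
at []       _             = 0
at (x ∷ xs) zero          = 0
at (x ∷ xs) (suc zero)    = x
at (x ∷ xs) (suc (suc k)) = at xs (suc k)

range1 : ℕ → List ℕ
range1 n = map suc (upTo n)

IsPerm : ℕ → List ℕ → Set
IsPerm n σ = σ ↭ range1 n

Avoids312 : ℕ → List ℕ → Set
Avoids312 n σ = ¬ (Σ ℕ λ a → Σ ℕ λ b → Σ ℕ λ c →
  1 ≤ a × a < b × b < c × c ≤ n × at σ b < at σ c × at σ c < at σ a)

-- length = number of inversions #{(i,j) : i<j, σ_i > σ_j}
inv : List ℕ → ℕ
inv []       = 0
inv (x ∷ xs) = length (filter (_<? x) xs) + inv xs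

-- R = {q₁ < ⋯ < q_r} ⊆ [n-1] is given as the strictly increasing list (q₁,…,q_r)
ValidR : ℕ → List ℕ → Set
ValidR n R = Linked _<_ R × All (λ q → 1 ≤ q × q + 1 ≤ n) R

-- q_h for h = 0,…,r+1 : the h-th entry of (q₀=0, q₁,…,q_r, q_{r+1}=n)
qseq : ℕ → List ℕ → List ℕ
qseq n R = 0 ∷ R ++ n ∷ []

q : ℕ → List ℕ → ℕ → ℕ
q n R h = at (qseq n R) (suc h)

-- the carrels (q_{h-1}, q_h], h = 1,…,r+1, as lists of entries of σ
carrelsFrom : List ℕ → List ℕ → List (List ℕ)
carrelsFrom (a ∷ b ∷ qs) σ = drop a (take b σ) ∷ carrelsFrom (b ∷ qs) σ
carrelsFrom _            σ = []

carrels : ℕ → List ℕ → List ℕ → List (List ℕ)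
carrels n R σ = carrelsFrom (qseq n R) σ

-- S_n^R : permutations strictly increasing on each carrel
IsRPerm : ℕ → List ℕ → List ℕ → Set
IsRPerm n R π = IsPerm n π × All (Linked _<_) (carrels n R π)

R312Containing : ℕ → List ℕ → List ℕ → Set
R312Containing n R π = Σ ℕ λ h → Σ ℕ λ a → Σ ℕ λ b → Σ ℕ λ c →
  1 ≤ h × h + 1 ≤ length R ×
  1 ≤ a × a ≤ q n R h × q n R h < b × b ≤ q n R (suc h) × q n R (suc h) < c × c ≤ n ×
  at π b < at π c × at π c < at π a

R312Avoiding : ℕ → List ℕ → List ℕ → Set
R312Avoiding n R π = ¬ R312Containing n R π

proj : ℕ → List ℕ → List ℕ → List ℕ
proj n R σ = concat (map sort (carrels n R σ))

B : ℕ → List ℕ → List ℕ → ℕ → List ℕ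
B n R π h = take (q n R h) π

maxL : List ℕ → ℕ
maxL []       = 0
maxL (x ∷ xs) = x ⊔ maxL xs

block : ℕ → List ℕ → List ℕ → ℕ → List ℕ
block n R π h =
  reverse (sort (filter (_<? m) D)) ++ sort (filter (λ x → ¬? (x <? m)) D)
  where
  m : ℕ
  m = maxL (B n R π h)
  D : List ℕ
  D = filter (λ x → x ∉? B n R π h) (B n R π (suc h))

sigma : ℕ → List ℕ → List ℕ → List ℕ
sigma n R π = take (q n R 1) π ++ concat (map (block n R π) (range1 (length R)))

-- If the R-projection of σ′ is π, the carrels of σ′ are rearrangements of the carrels of π,
-- and the inversions of σ′ between different carrels depend only on the carrel contents.
-- So inv σ′ is minimised carrel by carrel. When σ′ avoids 312, the entries of the carrel
-- (q_h, q_{h+1}] that are below m = max B_h follow m in σ′, so they occur in decreasing order;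
-- among such arrangements, listing them first and the remaining entries afterwards in
-- increasing order (a "valley") has the fewest inversions, and is the only one to do so.
-- The permutation σ of the proposition is the concatenation of these valleys. A 312 pattern
-- of σ cannot lie inside one valley, and one spread over several carrels would, with its "3"
-- replaced by the maximum of the carrels before its "1", be an R-312 pattern of π.

module Submission where

open import Defs
open import Data.Nat using (ℕ; zero; suc; _+_; _≤_; _<_; _≥_; _<?_; _≤?_; z≤n; s≤s)
open import Data.Nat.Properties
open import Data.Nat.Solver using (module +-*-Solver)
open import Algebra.Properties.CommutativeSemigroup +-commutativeSemigroup using (x∙yz≈y∙xz)
open import Data.Empty using (⊥)
open import Data.List using (List; []; _∷_; _++_; filter; reverse; concat; map; length; take; drop; upTo; applyUpTo)
open import Data.List.Properties
  using ( ++-assoc; ++-identityʳ; length-++; length-map; length-take; length-drop; length-upTo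
        ; filter-++; filter-accept; filter-reject; filter-none; filter-all; filter-some
        ; unfold-reverse; take++drop≡id; take-take; drop-all; ∷-injective; map-∘; map-upTo )
open import Data.List.Membership.Propositional using (_∈_; _∉_)
open import Data.List.Membership.DecPropositional (Data.Nat._≟_) using (_∉?_)
open import Data.List.Membership.Propositional.Properties using (∈-filter⁻; ∈-++⁺ˡ; ∈-++⁺ʳ)
open import Data.List.Relation.Unary.Any using (Any; here; there)
open import Data.List.Relation.Unary.All as All using (All; []; _∷_)
import Data.List.Relation.Unary.All.Properties as Allₚ
open import Data.List.Relation.Unary.AllPairs as AllPairs using (AllPairs; []; _∷_)
import Data.List.Relation.Unary.AllPairs.Properties as AllPairsₚ
open import Data.List.Relation.Unary.Linked as Linked using (Linked; []; [-]; _∷_)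
import Data.List.Relation.Unary.Linked.Properties as Linkedₚ
open import Data.List.Relation.Unary.Unique.Propositional using (Unique)
import Data.List.Relation.Unary.Unique.Propositional.Properties as Uniqueₚ
open import Data.List.Relation.Binary.Pointwise using (Pointwise; []; _∷_)
open import Data.List.Relation.Binary.Sublist.Propositional {A = ℕ}
  using (_⊆_; []; _∷_; _∷ʳ_; ⊆-trans; minimum; from∈; to∈)
open import Data.List.Relation.Binary.Sublist.Propositional.Properties
  using (Any-resp-⊆; filter-⊆; ∷ˡ⁻; take-⊆; drop-⊆; take⁺; drop⁺-≥; drop⁺-⊆)
  renaming (++⁺ to ⊆-++⁺; ++⁺ʳ to ⊆-++⁺ʳ)
open import Data.List.Relation.Binary.Permutation.Propositional as ↭
  using (_↭_; prep; swap; ↭-sym; ↭-refl; ↭-trans; ↭⇒↭ₛ)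
open import Data.List.Relation.Binary.Permutation.Propositional.Properties
  using (∈-resp-↭; ↭-length; drop-∷; filter-↭; ↭-reverse; ++⁺; ++⁺ʳ)
open import Data.List.Sort.InsertionSort ≤-decTotalOrder using (sort)
import Data.List.Sort.InsertionSort.Properties ≤-decTotalOrder as Sort
open import Data.Product using (Σ; _×_; _,_; proj₁; proj₂)
open import Data.Sum using (_⊎_; inj₁; inj₂)
open import Data.Unit using (⊤; tt)
open import Function using (_∘_)
open import Relation.Nullary using (¬_; yes; no; contradiction)
open import Relation.Nullary.Decidable using (¬?)
open import Relation.Binary.PropositionalEquality
  using (_≡_; refl; sym; trans; cong; cong₂; subst; setoid; module ≡-Reasoning)
open import Data.List.Relation.Binary.Permutation.Setoid.Properties (setoid ℕ) using (Unique-resp-↭)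

-- Inversions

countBelow : ℕ → List ℕ → ℕ
countBelow x ys = length (filter (_<? x) ys)

countBelow-++ : ∀ x xs ys → countBelow x (xs ++ ys) ≡ countBelow x xs + countBelow x ys
countBelow-++ x xs ys = trans (cong length (filter-++ (_<? x) xs ys)) (length-++ (filter (_<? x) xs))

countBelow-↭ : ∀ x {ys zs} → ys ↭ zs → countBelow x ys ≡ countBelow x zs
countBelow-↭ x p = ↭-length (filter-↭ (_<? x) p)

crossInv : List ℕ → List ℕ → ℕ
crossInv []       ys = 0
crossInv (x ∷ xs) ys = countBelow x ys + crossInv xs ys

crossInv-↭ˡ : ∀ {xs ys} zs → xs ↭ ys → crossInv xs zs ≡ crossInv ys zs
crossInv-↭ˡ zs ↭.refl        = refl
crossInv-↭ˡ zs (prep x p)    = cong (countBelow x zs +_) (crossInv-↭ˡ zs p)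
crossInv-↭ˡ zs (swap x y p)  = trans (x∙yz≈y∙xz (countBelow x zs) (countBelow y zs) _)
  (cong (λ c → countBelow y zs + (countBelow x zs + c)) (crossInv-↭ˡ zs p))
crossInv-↭ˡ zs (↭.trans p q) = trans (crossInv-↭ˡ zs p) (crossInv-↭ˡ zs q)

inv-++ : ∀ xs ys → inv (xs ++ ys) ≡ inv xs + (inv ys + crossInv xs ys)
inv-++ []       ys = sym (+-identityʳ (inv ys))
inv-++ (x ∷ xs) ys = begin
  countBelow x (xs ++ ys) + inv (xs ++ ys) ≡⟨ cong₂ _+_ (countBelow-++ x xs ys) (inv-++ xs ys) ⟩
  (a + b) + (c + (d + e))                  ≡⟨ shuffle a b c d e ⟩
  (a + c) + (d + (b + e))                  ∎
  where
  open ≡-Reasoning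
  shuffle : ∀ a b c d e → (a + b) + (c + (d + e)) ≡ (a + c) + (d + (b + e))
  shuffle = solve 5 (λ a b c d e → (a :+ b) :+ (c :+ (d :+ e)) := (a :+ c) :+ (d :+ (b :+ e))) refl
    where open +-*-Solver
  a = countBelow x xs
  b = countBelow x ys
  c = inv xs
  d = inv ys
  e = crossInv xs ys

Ascending : List ℕ → Set
Ascending = AllPairs _≤_

Descending : List ℕ → Set
Descending = AllPairs _≥_

inv-ascending : ∀ {xs} → Ascending xs → inv xs ≡ 0
inv-ascending {[]}     []        = refl
inv-ascending {x ∷ xs} (x≤ ∷ xs↗) =
  cong₂ _+_ (cong length (filter-none (_<? x) (All.map ≤⇒≯ x≤))) (inv-ascending xs↗)

inv≡0⇒ascending : ∀ xs → inv xs ≡ 0 → Ascending xs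
inv≡0⇒ascending []       _ = []
inv≡0⇒ascending (x ∷ xs) e =
  All.map ≮⇒≥ (Allₚ.¬Any⇒All¬ xs none-below) ∷ inv≡0⇒ascending xs (m+n≡0⇒n≡0 _ e)
  where
  none-below : ¬ Any (_< x) xs
  none-below some = n≮n 0 (subst (0 <_) (m+n≡0⇒m≡0 _ e) (filter-some (_<? x) some))

AllPairs-↭-unique : ∀ {R : ℕ → ℕ → Set} → (∀ {a b} → R a b → R b a → a ≡ b) →
  ∀ {xs ys} → AllPairs R xs → AllPairs R ys → xs ↭ ys → xs ≡ ys
AllPairs-↭-unique anti {[]}     {[]}     _ _ _ = refl
AllPairs-↭-unique anti {[]}     {_ ∷ _}  _ _ p with () ← ↭-length p
AllPairs-↭-unique anti {_ ∷ _}  {[]}     _ _ p with () ← ↭-length p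
AllPairs-↭-unique anti {x ∷ xs} {y ∷ ys} (x~ ∷ xs~) (y~ ∷ ys~) p =
  cong₂ _∷_ x≡y (AllPairs-↭-unique anti xs~ ys~ (drop-∷ (subst (λ z → z ∷ xs ↭ y ∷ ys) x≡y p)))
  where
  x≡y : x ≡ y
  x≡y with ∈-resp-↭ p (here refl) | ∈-resp-↭ (↭-sym p) (here refl)
  ... | here e  | _       = e
  ... | there _ | here e  = sym e
  ... | there i | there j = anti (All.lookup x~ j) (All.lookup y~ i)

strict⇒ascending : ∀ {xs} → Linked _<_ xs → Ascending xs
strict⇒ascending xs↗ = AllPairs.map <⇒≤ (Linkedₚ.Linked⇒AllPairs <-trans xs↗)

sort-ascending : ∀ xs → Ascending (sort xs)
sort-ascending xs = Linkedₚ.Linked⇒AllPairs ≤-trans (Sort.sort-↗ xs)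

reverse-AllPairs : ∀ {R : ℕ → ℕ → Set} {xs} → AllPairs R xs → AllPairs (λ a b → R b a) (reverse xs)
reverse-AllPairs {xs = []}     []       = []
reverse-AllPairs {xs = x ∷ xs} (x~ ∷ p) rewrite unfold-reverse x xs =
  AllPairsₚ.++⁺ (reverse-AllPairs p) ([] ∷ [])
    (All.tabulate (λ y∈ → All.lookup x~ (∈-resp-↭ (↭-reverse xs) y∈) ∷ []))

sort-unique : ∀ {xs ys} → Ascending ys → xs ↭ ys → sort xs ≡ ys
sort-unique {xs} ys↗ p = AllPairs-↭-unique ≤-antisym (sort-ascending xs) ys↗ (↭-trans (Sort.sort-↭ xs) p)

infix 4 _≼_

-- Carrying the equality case in the relation lets uniqueness of the minimiser compose along
-- _++_ just as the bound does.
_≼_ : List ℕ → List ℕ → Set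
xs ≼ ys = xs ↭ ys × inv xs ≤ inv ys × (inv ys ≡ inv xs → ys ≡ xs)

≼-refl : ∀ {xs} → xs ≼ xs
≼-refl = ↭-refl , ≤-refl , λ _ → refl

≼-trans : ∀ {xs ys zs} → xs ≼ ys → ys ≼ zs → xs ≼ zs
≼-trans {xs} {ys} {zs} (p , le , eq) (q , le′ , eq′) = ↭-trans p q , ≤-trans le le′ , zs≡xs
  where
  zs≡xs : inv zs ≡ inv xs → zs ≡ xs
  zs≡xs e = trans (eq′ (trans e (sym ys≡xs))) (eq ys≡xs)
    where
    ys≡xs : inv ys ≡ inv xs
    ys≡xs = ≤-antisym (subst (inv ys ≤_) e le′) le

<inv⇒≼ : ∀ {xs ys} → xs ↭ ys → inv xs < inv ys → xs ≼ ys
<inv⇒≼ p lt = p , <⇒≤ lt , λ e → contradiction (sym e) (<⇒≢ lt)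

≼-∷ : ∀ x {xs ys} → xs ≼ ys → x ∷ xs ≼ x ∷ ys
≼-∷ x {xs} {ys} (p , le , eq) = prep x p , +-mono-≤ (≤-reflexive same-count) le ,
  λ e → cong (x ∷_) (eq (+-cancelˡ-≡ (countBelow x xs) _ _ (trans (cong (_+ inv ys) same-count) e)))
  where
  same-count : countBelow x xs ≡ countBelow x ys
  same-count = countBelow-↭ x p

≼-++ˡ : ∀ zs {xs ys} → xs ≼ ys → zs ++ xs ≼ zs ++ ys
≼-++ˡ []       p = p
≼-++ˡ (z ∷ zs) p = ≼-∷ z (≼-++ˡ zs p)

≼-++ʳ : ∀ zs {xs ys} → xs ≼ ys → xs ++ zs ≼ ys ++ zs
≼-++ʳ zs {xs} {ys} (p , le , eq) = ++⁺ʳ zs p , inv-≤ , inv-≡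
  where
  k : ℕ
  k = inv zs + crossInv xs zs
  inv-ys++zs : inv (ys ++ zs) ≡ inv ys + k
  inv-ys++zs = trans (inv-++ ys zs) (cong (λ c → inv ys + (inv zs + c)) (sym (crossInv-↭ˡ zs p)))
  inv-≤ : inv (xs ++ zs) ≤ inv (ys ++ zs)
  inv-≤ rewrite inv-++ xs zs | inv-ys++zs = +-monoˡ-≤ k le
  inv-≡ : inv (ys ++ zs) ≡ inv (xs ++ zs) → ys ++ zs ≡ xs ++ zs
  inv-≡ e = cong (_++ zs) (eq (+-cancelʳ-≡ k _ _ (trans (sym inv-ys++zs) (trans e (inv-++ xs zs)))))

≼-++ : ∀ {xs ys us vs} → xs ≼ ys → us ≼ vs → xs ++ us ≼ ys ++ vs
≼-++ {ys = ys} {us} p q = ≼-trans (≼-++ʳ us p) (≼-++ˡ ys q)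

≼-concat : ∀ {xss yss} → Pointwise _≼_ xss yss → concat xss ≼ concat yss
≼-concat []       = ≼-refl
≼-concat (p ∷ ps) = ≼-++ p (≼-concat ps)

ascending-≼ : ∀ {xs ys} → Ascending xs → xs ↭ ys → xs ≼ ys
ascending-≼ {xs} {ys} xs↗ p = p , subst (_≤ inv ys) (sym (inv-ascending xs↗)) z≤n ,
  λ e → AllPairs-↭-unique ≤-antisym (inv≡0⇒ascending ys (trans e (inv-ascending xs↗))) xs↗ (↭-sym p)

swap-≼ : ∀ {x y} zs → x < y → x ∷ y ∷ zs ≼ y ∷ x ∷ zs
swap-≼ {x} {y} zs x<y = <inv⇒≼ (swap x y ↭-refl) (begin-strict
  countBelow x (y ∷ zs) + (countBelow y zs + inv zs) ≡⟨ cong (λ c → length c + _) (filter-reject (_<? x) (<⇒≯ x<y)) ⟩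
  countBelow x zs + (countBelow y zs + inv zs)       ≡⟨ x∙yz≈y∙xz (countBelow x zs) (countBelow y zs) (inv zs) ⟩
  countBelow y zs + (countBelow x zs + inv zs)       <⟨ n<1+n _ ⟩
  suc (countBelow y zs) + (countBelow x zs + inv zs) ≡⟨ cong (λ c → length c + _) (filter-accept (_<? y) x<y) ⟨
  countBelow y (x ∷ zs) + (countBelow x zs + inv zs) ∎)
  where open ≤-Reasoning

shift-≼ : ∀ {y xs} zs → All (_< y) xs → xs ++ y ∷ zs ≼ y ∷ xs ++ zs
shift-≼ zs []                   = ≼-refl
shift-≼ zs (_∷_ {x} {xs} x<y xs<y) = ≼-trans (≼-∷ x (shift-≼ zs xs<y)) (swap-≼ (xs ++ zs) x<y)

-- Valleys

lower upper : ℕ → List ℕ → List ℕ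
lower m = filter (_<? m)
upper m = filter (λ x → ¬? (x <? m))

lower++upper-≼ : ∀ m ys → lower m ys ++ upper m ys ≼ ys
lower++upper-≼ m []       = ≼-refl
lower++upper-≼ m (y ∷ ys) with y <? m
... | yes y<m
  rewrite filter-accept (_<? m) {xs = ys} y<m | filter-reject (λ x → ¬? (x <? m)) {xs = ys} (λ y≮m → y≮m y<m)
  = ≼-∷ y (lower++upper-≼ m ys)
... | no  y≮m
  rewrite filter-reject (_<? m) {xs = ys} y≮m | filter-accept (λ x → ¬? (x <? m)) {xs = ys} y≮m
  = ≼-trans (shift-≼ (upper m ys) lower<y) (≼-∷ y (lower++upper-≼ m ys))
  where
  lower<y : All (_< y) (lower m ys)
  lower<y = All.map (λ x<m → <-≤-trans x<m (≮⇒≥ y≮m)) (Allₚ.all-filter (_<? m) ys)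

valley : ℕ → List ℕ → List ℕ
valley m C = reverse (sort (lower m C)) ++ sort (upper m C)

valley-↭ : ∀ m C → valley m C ↭ C
valley-↭ m C = ↭-trans
  (++⁺ (↭-trans (↭-reverse (sort (lower m C))) (Sort.sort-↭ (lower m C))) (Sort.sort-↭ (upper m C)))
  (proj₁ (lower++upper-≼ m C))

-- Only the entries ≥ m are free: putting them last and in increasing order strictly lowers inv
-- unless Y is already the valley.
valley-≼ : ∀ m {C Y} → Y ↭ C → Descending (lower m Y) → valley m C ≼ Y
valley-≼ m {C} {Y} Y↭C lowerY↘ = subst (_≼ Y) (cong (_++ sort (upper m C)) lowerY≡)
  (≼-trans (≼-++ˡ (lower m Y) (ascending-≼ (sort-ascending (upper m C)) sort-upper↭)) (lower++upper-≼ m Y))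
  where
  lowerY≡ : lower m Y ≡ reverse (sort (lower m C))
  lowerY≡ = AllPairs-↭-unique (λ a≥b b≥a → ≤-antisym b≥a a≥b) lowerY↘
    (reverse-AllPairs (sort-ascending (lower m C)))
    (↭-trans (filter-↭ (_<? m) Y↭C) (↭-sym (↭-trans (↭-reverse (sort (lower m C))) (Sort.sort-↭ (lower m C)))))
  sort-upper↭ : sort (upper m C) ↭ upper m Y
  sort-upper↭ = ↭-trans (Sort.sort-↭ (upper m C)) (filter-↭ (λ x → ¬? (x <? m)) (↭-sym Y↭C))

valley-0 : ∀ {C} → Ascending C → valley 0 C ≡ C
valley-0 {C} C↗
  rewrite filter-none (_<? 0) (All.universal (λ _ ()) C) | filter-all (λ x → ¬? (x <? 0)) (All.universal (λ _ ()) C)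
  = sort-unique C↗ ↭-refl

-- Sublists and 312 patterns

⊆-++⁻ : ∀ P {Q xs} → xs ⊆ P ++ Q →
  Σ (List ℕ) λ ys → Σ (List ℕ) λ zs → xs ≡ ys ++ zs × ys ⊆ P × zs ⊆ Q
⊆-++⁻ []      s          = [] , _ , refl , [] , s
⊆-++⁻ (p ∷ P) (.p ∷ʳ s)  with ⊆-++⁻ P s
... | ys , zs , refl , s₁ , s₂ = ys , zs , refl , p ∷ʳ s₁ , s₂
⊆-++⁻ (p ∷ P) (refl ∷ s) with ⊆-++⁻ P s
... | ys , zs , refl , s₁ , s₂ = p ∷ ys , zs , refl , refl ∷ s₁ , s₂

AllPairs⇒⊆-pair : ∀ {R : ℕ → ℕ → Set} {L u v} → AllPairs R L → u ∷ v ∷ [] ⊆ L → R u v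
AllPairs⇒⊆-pair (_  ∷ p) (_ ∷ʳ s)   = AllPairs⇒⊆-pair p s
AllPairs⇒⊆-pair (px ∷ _) (refl ∷ s) = All.lookup px (to∈ s)

⊆-pairs⇒AllPairs : ∀ {R : ℕ → ℕ → Set} {L} → (∀ {u v} → u ∷ v ∷ [] ⊆ L → R u v) → AllPairs R L
⊆-pairs⇒AllPairs {L = []}    f = []
⊆-pairs⇒AllPairs {L = x ∷ L} f =
  All.tabulate (λ v∈ → f (refl ∷ from∈ v∈)) ∷ ⊆-pairs⇒AllPairs (λ s → f (x ∷ʳ s))

SubAvoids312 : List ℕ → Set
SubAvoids312 L = ∀ {x y z} → x ∷ y ∷ z ∷ [] ⊆ L → y < z → z < x → ⊥

Avoids312Into : List ℕ → List ℕ → Set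
Avoids312Into P Z = ∀ {x y z} → x ∷ y ∷ [] ⊆ P → z ∈ Z → y < z → z < x → ⊥

at-⊆ : ∀ {xs} L a b → a < b → b ≤ length L → xs ⊆ drop b L → at L b ∷ xs ⊆ drop a L
at-⊆ []      _       (suc _)       _         ()       _
at-⊆ (y ∷ L) zero    (suc zero)    _         _        s = refl ∷ s
at-⊆ (y ∷ L) zero    (suc (suc b)) _         (s≤s b≤) s = y ∷ʳ at-⊆ L zero (suc b) (s≤s z≤n) b≤ s
at-⊆ (y ∷ L) (suc a) (suc zero)    (s≤s ())  _        _
at-⊆ (y ∷ L) (suc a) (suc (suc b)) (s≤s a<b) (s≤s b≤) s = at-⊆ L a (suc b) a<b b≤ s

⊆-at : ∀ {x xs} L a → x ∷ xs ⊆ drop a L → Σ ℕ λ b → a < b × b ≤ length L × at L b ≡ x × xs ⊆ drop b L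
⊆-at []      zero    ()
⊆-at []      (suc a) ()
⊆-at (y ∷ L) zero    (refl ∷ s) = 1 , s≤s z≤n , s≤s z≤n , refl , s
⊆-at (y ∷ L) zero    (.y ∷ʳ s)  with ⊆-at L zero s
... | suc b , _ , b≤ , e , s′ = suc (suc b) , s≤s z≤n , s≤s b≤ , e , s′
⊆-at (y ∷ L) (suc a) s          with ⊆-at L a s
... | suc b , a<b , b≤ , e , s′ = suc (suc b) , s≤s a<b , s≤s b≤ , e , s′

SubAvoids312⇒Avoids312 : ∀ σ → SubAvoids312 σ → Avoids312 (length σ) σ
SubAvoids312⇒Avoids312 σ av (a , b , c , 0<a , a<b , b<c , c≤ , yz , zx) = av
  (at-⊆ σ 0 a 0<a (≤-trans (<⇒≤ (<-trans a<b b<c)) c≤)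
    (at-⊆ σ a b a<b (≤-trans (<⇒≤ b<c) c≤)
      (at-⊆ σ b c b<c c≤ (minimum _))))
  yz zx

Avoids312⇒SubAvoids312 : ∀ σ → Avoids312 (length σ) σ → SubAvoids312 σ
Avoids312⇒SubAvoids312 σ av s yz zx with ⊆-at σ 0 s
... | a , 0<a , _ , refl , s₁ with ⊆-at σ a s₁
... | b , a<b , _ , refl , s₂ with ⊆-at σ b s₂
... | c , b<c , c≤ , refl , _ = av (a , b , c , 0<a , a<b , b<c , c≤ , yz , zx)

module _ (m : ℕ) (C : List ℕ) where

  private
    descent-< : ∀ {x} → x ∈ reverse (sort (lower m C)) → x < m
    descent-< i = proj₂ (∈-filter⁻ (_<? m) {xs = C}
      (∈-resp-↭ (Sort.sort-↭ (lower m C)) (∈-resp-↭ (↭-reverse (sort (lower m C))) i)))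

    ascent-≥ : ∀ {x} → x ∈ sort (upper m C) → m ≤ x
    ascent-≥ i = ≮⇒≥ (proj₂ (∈-filter⁻ (λ x → ¬? (x <? m)) {xs = C}
      (∈-resp-↭ (Sort.sort-↭ (upper m C)) i)))

  valley-pair : ∀ {u v} → u ∷ v ∷ [] ⊆ valley m C → (v ≤ u × u < m) ⊎ (u ≤ v × m ≤ v)
  valley-pair s with ⊆-++⁻ (reverse (sort (lower m C))) s
  ... | []            , _ , refl , _  , s₂ =
    inj₂ (AllPairs⇒⊆-pair (sort-ascending (upper m C)) s₂ , ascent-≥ (to∈ (∷ˡ⁻ s₂)))
  ... | _ ∷ []        , _ , refl , s₁ , s₂ =
    inj₂ (<⇒≤ (<-≤-trans (descent-< (to∈ s₁)) (ascent-≥ (to∈ s₂))) , ascent-≥ (to∈ s₂))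
  ... | _ ∷ _ ∷ []    , _ , refl , s₁ , _  =
    inj₁ (AllPairs⇒⊆-pair (reverse-AllPairs (sort-ascending (lower m C))) s₁ , descent-< (to∈ s₁))
  ... | _ ∷ _ ∷ _ ∷ _ , _ , ()   , _  , _

  SubAvoids312-++valley : ∀ {P Z} → All (_≤ m) P → SubAvoids312 P → Avoids312Into P Z →
    (∀ {y} → y ∈ C → y ∈ Z) → SubAvoids312 (P ++ valley m C)
  SubAvoids312-++valley {P} P≤m avP P↝Z C⊆Z s yz zx with ⊆-++⁻ P s
  ... | [] , _ , refl , _ , s₂ with valley-pair (∷ˡ⁻ s₂) | valley-pair (⊆-trans (refl ∷ _ ∷ʳ refl ∷ []) s₂)
  ...   | inj₁ (z≤y , _) | _                = <⇒≱ yz z≤y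
  ...   | inj₂ (_ , m≤z) | inj₁ (z≤x , x<m) = <⇒≱ (≤-<-trans z≤x x<m) m≤z
  ...   | inj₂ _         | inj₂ (x≤z , _)   = <⇒≱ zx x≤z
  SubAvoids312-++valley {P} P≤m avP P↝Z C⊆Z s yz zx | _ ∷ [] , _ , refl , s₁ , s₂ with valley-pair s₂
  ...   | inj₁ (z≤y , _) = <⇒≱ yz z≤y
  ...   | inj₂ (_ , m≤z) = <⇒≱ zx (≤-trans (All.lookup P≤m (to∈ s₁)) m≤z)
  SubAvoids312-++valley {P} P≤m avP P↝Z C⊆Z s yz zx | _ ∷ _ ∷ [] , _ , refl , s₁ , s₂ =
    P↝Z s₁ (C⊆Z (∈-resp-↭ (valley-↭ m C) (to∈ s₂))) yz zx
  SubAvoids312-++valley {P} P≤m avP P↝Z C⊆Z s yz zx | _ ∷ _ ∷ _ ∷ [] , _ , refl , s₁ , _ = avP s₁ yz zx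
  SubAvoids312-++valley {P} P≤m avP P↝Z C⊆Z s yz zx | _ ∷ _ ∷ _ ∷ _ ∷ _ , _ , () , _ , _

  Avoids312Into-++valley : ∀ {P Z Z′} → All (_≤ m) P → Avoids312Into P Z → (∀ {z} → z ∈ Z′ → z ∈ Z) →
    (∀ {y z} → y ∈ C → z ∈ Z′ → y < z → z < m → ⊥) → Avoids312Into (P ++ valley m C) Z′
  Avoids312Into-++valley {P} P≤m P↝Z Z′⊆Z gap s z∈ yz zx with ⊆-++⁻ P s
  ... | [] , _ , refl , _ , s₂ with valley-pair s₂
  ...   | inj₁ (_ , x<m) = gap (∈-resp-↭ (valley-↭ m C) (to∈ (∷ˡ⁻ s₂))) z∈ yz (<-trans zx x<m)
  ...   | inj₂ (x≤y , _) = <⇒≱ (<-trans yz zx) x≤y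
  Avoids312Into-++valley {P} P≤m P↝Z Z′⊆Z gap s z∈ yz zx | _ ∷ [] , _ , refl , s₁ , s₂ =
    gap (∈-resp-↭ (valley-↭ m C) (to∈ s₂)) z∈ yz (<-≤-trans zx (All.lookup P≤m (to∈ s₁)))
  Avoids312Into-++valley {P} P≤m P↝Z Z′⊆Z gap s z∈ yz zx | _ ∷ _ ∷ [] , _ , refl , s₁ , _ =
    P↝Z s₁ (Z′⊆Z z∈) yz zx
  Avoids312Into-++valley {P} P≤m P↝Z Z′⊆Z gap s z∈ yz zx | _ ∷ _ ∷ _ ∷ _ , _ , () , _ , _

descending-lower : ∀ m Y → (∀ {u v} → u ∷ v ∷ [] ⊆ Y → u < v → v < m → ⊥) → Descending (lower m Y)
descending-lower m Y no-rise = ⊆-pairs⇒AllPairs λ s →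
  ≮⇒≥ (λ u<v → no-rise (⊆-trans s (filter-⊆ (_<? m) Y)) u<v
    (proj₂ (∈-filter⁻ (_<? m) {xs = Y} (to∈ (∷ˡ⁻ s)))))

take-length-++ : ∀ (U V : List ℕ) → take (length U) (U ++ V) ≡ U
take-length-++ []      V = refl
take-length-++ (u ∷ U) V = cong (u ∷_) (take-length-++ U V)

drop-length-++ : ∀ (U V : List ℕ) → drop (length U) (U ++ V) ≡ V
drop-length-++ []      V = refl
drop-length-++ (u ∷ U) V = drop-length-++ U V

drop-take++drop : ∀ {a b} (L : List ℕ) → a ≤ b → drop a (take b L) ++ drop b L ≡ drop a L
drop-take++drop {zero}  {b}     L       _         = take++drop≡id b L
drop-take++drop {suc a} {suc b} []      _         = refl
drop-take++drop {suc a} {suc b} (x ∷ L) (s≤s a≤b) = drop-take++drop L a≤b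

take-split : ∀ {a b} (L : List ℕ) → a ≤ b → take b L ≡ take a L ++ drop a (take b L)
take-split {a} {b} L a≤b = trans (sym (take++drop≡id a (take b L)))
  (cong (_++ drop a (take b L)) (trans (take-take a b L) (cong (λ k → take k L) (m≤n⇒m⊓n≡m a≤b))))

∈-slice⇒at : ∀ (L : List ℕ) a b {x} → x ∈ drop a (take b L) → Σ ℕ λ j → a < j × j ≤ b × at L j ≡ x
∈-slice⇒at L       zero    zero    ()
∈-slice⇒at []      zero    (suc b) ()
∈-slice⇒at L       (suc a) zero    ()
∈-slice⇒at []      (suc a) (suc b) ()
∈-slice⇒at (y ∷ L) zero    (suc b) (here refl) = 1 , s≤s z≤n , s≤s z≤n , refl
∈-slice⇒at (y ∷ L) zero    (suc b) (there x∈) with ∈-slice⇒at L zero b x∈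
... | suc j , _ , j≤b , e = suc (suc j) , s≤s z≤n , s≤s j≤b , e
∈-slice⇒at (y ∷ L) (suc a) (suc b) x∈ with ∈-slice⇒at L a b x∈
... | suc j , a<j , j≤b , e = suc (suc j) , s≤s a<j , s≤s j≤b , e

at-last : ∀ {n} R → at (R ++ n ∷ []) (suc (length R)) ≡ n
at-last []          = refl
at-last (r ∷ [])    = refl
at-last (r ∷ s ∷ R) = at-last (s ∷ R)

Linked-from-at : ∀ {P : ℕ → ℕ → Set} L →
  (∀ i → suc i < length L → P (at L (suc i)) (at L (suc (suc i)))) → Linked P L
Linked-from-at []          _ = []
Linked-from-at (a ∷ [])    _ = [-]
Linked-from-at (a ∷ b ∷ L) H = H 0 (s≤s (s≤s z≤n)) ∷ Linked-from-at (b ∷ L) (λ i lt → H (suc i) (s≤s lt))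

maxL-ub : ∀ {x L} → x ∈ L → x ≤ maxL L
maxL-ub {L = y ∷ L} (here refl) = m≤m⊔n y (maxL L)
maxL-ub {L = y ∷ L} (there i)   = ≤-trans (maxL-ub i) (m≤n⊔m y (maxL L))

maxL-∈ : ∀ L → 0 < maxL L → maxL L ∈ L
maxL-∈ (y ∷ L) 0<max with ⊔-sel y (maxL L)
... | inj₁ e = subst (_∈ y ∷ L) (sym e) (here refl)
... | inj₂ e = subst (_∈ y ∷ L) (sym e) (there (maxL-∈ L (subst (0 <_) e 0<max)))

Unique-++⇒disjoint : ∀ (xs : List ℕ) {ys x} → Unique (xs ++ ys) → x ∈ xs → x ∉ ys
Unique-++⇒disjoint (_ ∷ xs) (x∉ ∷ _) (here refl) j = All.lookup x∉ (∈-++⁺ʳ xs j) refl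
Unique-++⇒disjoint (_ ∷ xs) (_ ∷ u)  (there i)   j = Unique-++⇒disjoint xs u i j

↭-concat⁺ : ∀ {Xs Ys : List (List ℕ)} → Pointwise _↭_ Xs Ys → concat Xs ↭ concat Ys
↭-concat⁺ []       = ↭-refl
↭-concat⁺ (p ∷ ps) = ++⁺ p (↭-concat⁺ ps)

sort-↭-pointwise : ∀ (Xs : List (List ℕ)) → Pointwise _↭_ (map sort Xs) Xs
sort-↭-pointwise []       = []
sort-↭-pointwise (X ∷ Xs) = Sort.sort-↭ X ∷ sort-↭-pointwise Xs

IsPerm⇒length : ∀ {n σ} → IsPerm n σ → length σ ≡ n
IsPerm⇒length {n} σ↭ = trans (↭-length σ↭) (trans (length-map suc (upTo n)) (length-upTo n))

IsPerm⇒Unique : ∀ {n σ} → IsPerm n σ → Unique σ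
IsPerm⇒Unique {n} σ↭ = Unique-resp-↭ (↭⇒↭ₛ (↭-sym σ↭)) (Uniqueₚ.map⁺ suc-injective (Uniqueₚ.upTo⁺ n))

-- Cut points and carrels

CutsTo : ℕ → List ℕ → Set
CutsTo n []           = ⊥
CutsTo n (a ∷ [])     = a ≡ n
CutsTo n (a ∷ b ∷ qs) = a ≤ b × CutsTo n (b ∷ qs)

CutsTo-≤ : ∀ {n} a qs → CutsTo n (a ∷ qs) → a ≤ n
CutsTo-≤ a []       a≡n        = ≤-reflexive a≡n
CutsTo-≤ a (b ∷ qs) (a≤b , cs) = ≤-trans a≤b (CutsTo-≤ b qs cs)

CutsTo-++ : ∀ {n} a R → Linked _≤_ (a ∷ R) → All (_≤ n) (a ∷ R) → CutsTo n (a ∷ R ++ n ∷ [])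
CutsTo-++ a []      _           (a≤n ∷ []) = a≤n , refl
CutsTo-++ a (b ∷ R) (a≤b ∷ R↗) (_ ∷ ≤n)   = a≤b , CutsTo-++ b R R↗ ≤n

ValidR⇒CutsTo : ∀ n R → ValidR n R → CutsTo n (qseq n R)
ValidR⇒CutsTo n []      _            = CutsTo-++ 0 [] [-] (z≤n ∷ [])
ValidR⇒CutsTo n (r ∷ R) (R↗ , inside) =
  CutsTo-++ 0 (r ∷ R) (z≤n ∷ Linked.map <⇒≤ R↗)
    (z≤n ∷ All.map (λ (_ , q+1≤n) → ≤-trans (m≤m+n _ 1) q+1≤n) inside)

concat-carrelsFrom : ∀ {n} (L : List ℕ) a qs → length L ≡ n → CutsTo n (a ∷ qs) →
  concat (carrelsFrom (a ∷ qs) L) ≡ drop a L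
concat-carrelsFrom L a []       |L| a≡n        = sym (drop-all a L (≤-reflexive (trans |L| (sym a≡n))))
concat-carrelsFrom L a (b ∷ qs) |L| (a≤b , cs) =
  trans (cong (drop a (take b L) ++_) (concat-carrelsFrom L b qs |L| cs)) (drop-take++drop L a≤b)

Tiles : List ℕ → List (List ℕ) → Set
Tiles (a ∷ [])     []       = ⊤
Tiles (a ∷ b ∷ qs) (X ∷ Xs) = a + length X ≡ b × Tiles (b ∷ qs) Xs
Tiles _            _        = ⊥

Tiles-carrelsFrom : ∀ {n} (L : List ℕ) a qs → length L ≡ n → CutsTo n (a ∷ qs) →
  Tiles (a ∷ qs) (carrelsFrom (a ∷ qs) L)
Tiles-carrelsFrom L a []       |L| _          = tt
Tiles-carrelsFrom L a (b ∷ qs) |L| (a≤b , cs) = a+|carrel|≡b , Tiles-carrelsFrom L b qs |L| cs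
  where
  a+|carrel|≡b : a + length (drop a (take b L)) ≡ b
  a+|carrel|≡b rewrite length-drop a (take b L) | length-take b L
    | m≤n⇒m⊓n≡m (≤-trans (CutsTo-≤ b qs cs) (≤-reflexive (sym |L|))) = m+[n∸m]≡n a≤b

Tiles-↭ : ∀ qs {Xs Ys} → Pointwise _↭_ Ys Xs → Tiles qs Xs → Tiles qs Ys
Tiles-↭ (a ∷ [])     []       t        = t
Tiles-↭ (a ∷ b ∷ qs) (p ∷ ps) (e , t) = trans (cong (a +_) (↭-length p)) e , Tiles-↭ (b ∷ qs) ps t

carrelsFrom-++concat : ∀ a qs {Xs} (W : List ℕ) → Tiles (a ∷ qs) Xs → length W ≡ a →
  carrelsFrom (a ∷ qs) (W ++ concat Xs) ≡ Xs
carrelsFrom-++concat a []       {[]}     W t        |W| = refl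
carrelsFrom-++concat a (b ∷ qs) {X ∷ Xs} W (e , t) |W|
  rewrite sym (++-assoc W X (concat Xs)) = cong₂ _∷_ first-carrel (carrelsFrom-++concat b qs (W ++ X) t |W++X|)
  where
  |W++X| : length (W ++ X) ≡ b
  |W++X| = trans (length-++ W) (trans (cong (_+ length X) |W|) e)
  first-carrel : drop a (take b ((W ++ X) ++ concat Xs)) ≡ X
  first-carrel rewrite sym |W++X| | take-length-++ (W ++ X) (concat Xs) | sym |W| = drop-length-++ W X

carrels-proj : ∀ {n} (σ : List ℕ) qs → length σ ≡ n → CutsTo n (0 ∷ qs) →
  carrelsFrom (0 ∷ qs) (concat (map sort (carrelsFrom (0 ∷ qs) σ))) ≡ map sort (carrelsFrom (0 ∷ qs) σ)
carrels-proj σ qs |σ| cuts =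
  carrelsFrom-++concat 0 qs [] (Tiles-↭ (0 ∷ qs) (sort-↭-pointwise _) (Tiles-carrelsFrom σ 0 qs |σ| cuts)) refl

pairwise : (ℕ → ℕ → List ℕ) → List ℕ → List (List ℕ)
pairwise f (a ∷ b ∷ qs) = f a b ∷ pairwise f (b ∷ qs)
pairwise f _            = []

pairwise-at : ∀ f qs k → suc k ≡ length qs →
  map (λ i → f (at qs (suc i)) (at qs (suc (suc i)))) (upTo k) ≡ pairwise f qs
pairwise-at f (a ∷ [])     zero    _ = refl
pairwise-at f (a ∷ b ∷ qs) (suc k) e = cong (f a b ∷_) (begin
  map F (applyUpTo suc k)  ≡⟨ cong (map F) (map-upTo suc k) ⟨
  map F (map suc (upTo k)) ≡⟨ map-∘ (upTo k) ⟨
  map (F ∘ suc) (upTo k)   ≡⟨ pairwise-at f (b ∷ qs) k (suc-injective e) ⟩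
  pairwise f (b ∷ qs)      ∎)
  where
  open ≡-Reasoning
  F : ℕ → List ℕ
  F i = f (at (a ∷ b ∷ qs) (suc i)) (at (a ∷ b ∷ qs) (suc (suc i)))

pairwise-cong : ∀ {f g n} qs → (∀ {a b} → a ≤ b → f a b ≡ g a b) → CutsTo n qs →
  pairwise f qs ≡ pairwise g qs
pairwise-cong (a ∷ [])     f≡g _            = refl
pairwise-cong (a ∷ b ∷ qs) f≡g (a≤b , cuts) = cong₂ _∷_ (f≡g a≤b) (pairwise-cong (b ∷ qs) f≡g cuts)

module Valleys (π : List ℕ) where

  valleyBlock : ℕ → ℕ → List ℕ
  valleyBlock a b = valley (maxL (take a π)) (drop a (take b π))

  valleys : List ℕ → List (List ℕ)
  valleys = pairwise valleyBlock

  valleys-↭ : ∀ qs → Pointwise _↭_ (valleys qs) (carrelsFrom qs π)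
  valleys-↭ []           = []
  valleys-↭ (a ∷ [])     = []
  valleys-↭ (a ∷ b ∷ qs) = valley-↭ _ _ ∷ valleys-↭ (b ∷ qs)

  sort-valleys : ∀ qs → All (Linked _<_) (carrelsFrom qs π) → map sort (valleys qs) ≡ carrelsFrom qs π
  sort-valleys []           _          = refl
  sort-valleys (a ∷ [])     _          = refl
  sort-valleys (a ∷ b ∷ qs) (C↗ ∷ Cs↗) =
    cong₂ _∷_ (sort-unique (strict⇒ascending C↗) (valley-↭ _ _)) (sort-valleys (b ∷ qs) Cs↗)

  -- R-312 patterns of π with the 3 before the cut a, the 1 in the carrel (a, b] and the 2 after b.
  Avoids312Across : ℕ → ℕ → Set
  Avoids312Across a b =
    ∀ {m y z} → m ∈ take a π → y ∈ drop a (take b π) → z ∈ drop b π → y < z → z < m → ⊥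

  SubAvoids312-valleys : ∀ {n} a qs {P} → CutsTo n (a ∷ qs) → Linked Avoids312Across (a ∷ qs) →
    All (_∈ take a π) P → SubAvoids312 P → Avoids312Into P (drop a π) →
    SubAvoids312 (P ++ concat (valleys (a ∷ qs)))
  SubAvoids312-valleys a []       {P} _            _                   _  avP _   =
    subst SubAvoids312 (sym (++-identityʳ P)) avP
  SubAvoids312-valleys a (b ∷ qs) {P} (a≤b , cuts) (across ∷ acrosses) P⊆ avP P↝Z =
    subst SubAvoids312 (++-assoc P (valleyBlock a b) _) (SubAvoids312-valleys b qs cuts acrosses P′⊆
      (SubAvoids312-++valley m C P≤m avP P↝Z (Any-resp-⊆ (drop⁺-⊆ a (take-⊆ b π))))
      (Avoids312Into-++valley m C P≤m P↝Z (Any-resp-⊆ (drop⁺-≥ a≤b)) gap))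
    where
    m = maxL (take a π)
    C = drop a (take b π)
    P≤m : All (_≤ m) P
    P≤m = All.map maxL-ub P⊆
    gap : ∀ {y z} → y ∈ C → z ∈ drop b π → y < z → z < m → ⊥
    gap y∈ z∈ yz zm = across (maxL-∈ (take a π) (≤-<-trans z≤n zm)) y∈ z∈ yz zm
    P′⊆ : All (_∈ take b π) (P ++ valley m C)
    P′⊆ = Allₚ.++⁺ (All.map (Any-resp-⊆ (take⁺ a≤b)) P⊆)
                  (All.tabulate (λ i → Any-resp-⊆ (drop-⊆ a (take b π)) (∈-resp-↭ (valley-↭ m C) i)))

  valleys-≼ : ∀ {n} a qs {P Ys} → CutsTo n (a ∷ qs) → All (_∈ P) (take a π) → SubAvoids312 (P ++ concat Ys) →
    map sort Ys ≡ carrelsFrom (a ∷ qs) π → Pointwise _≼_ (valleys (a ∷ qs)) Ys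
  valleys-≼ a []       {Ys = []}     _ _ _ _  = []
  valleys-≼ a []       {Ys = _ ∷ _}  _ _ _ ()
  valleys-≼ a (b ∷ qs) {Ys = []}     _ _ _ ()
  valleys-≼ a (b ∷ qs) {P} {Y ∷ Ys} (a≤b , cuts) π⊆P avP sorts with ∷-injective sorts
  ... | sortY , sortYs = valley-≼ m Y↭C (descending-lower m Y no-rise)
      ∷ valleys-≼ b qs cuts π⊆P′ (subst SubAvoids312 (sym (++-assoc P Y _)) avP) sortYs
    where
    m = maxL (take a π)
    Y↭C : Y ↭ drop a (take b π)
    Y↭C = subst (Y ↭_) sortY (↭-sym (Sort.sort-↭ Y))
    no-rise : ∀ {u v} → u ∷ v ∷ [] ⊆ Y → u < v → v < m → ⊥
    no-rise s uv vm =
      avP (⊆-++⁺ (from∈ (All.lookup π⊆P (maxL-∈ (take a π) (≤-<-trans z≤n vm)))) (⊆-++⁺ʳ (concat Ys) s)) uv vm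
    π⊆P′ : All (_∈ P ++ Y) (take b π)
    π⊆P′ = subst (All (_∈ P ++ Y)) (sym (take-split π a≤b))
      (Allₚ.++⁺ (All.map ∈-++⁺ˡ π⊆P) (All.tabulate (λ i → ∈-++⁺ʳ P (∈-resp-↭ (↭-sym Y↭C) i))))

  -- By definition, block n R π h is freshBlock (q n R h) (q n R (suc h)).
  freshBlock : ℕ → ℕ → List ℕ
  freshBlock a b = valley (maxL (take a π)) (filter (_∉? take a π) (take b π))

  fresh-entries : Unique π → ∀ {a b} → a ≤ b → filter (_∉? take a π) (take b π) ≡ drop a (take b π)
  fresh-entries uπ {a} {b} a≤b = begin
    filter (_∉? take a π) (take b π)
      ≡⟨ cong (filter (_∉? take a π)) (take-split π a≤b) ⟩
    filter (_∉? take a π) (take a π ++ C)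
      ≡⟨ filter-++ (_∉? take a π) (take a π) C ⟩
    filter (_∉? take a π) (take a π) ++ filter (_∉? take a π) C
      ≡⟨ cong₂ _++_ (filter-none (_∉? take a π) old-rejected) (filter-all (_∉? take a π) new-accepted) ⟩
    C ∎
    where
    open ≡-Reasoning
    C = drop a (take b π)
    old-rejected : All (λ x → ¬ x ∉ take a π) (take a π)
    old-rejected = All.tabulate (λ i x∉ → x∉ i)
    new-accepted : All (_∉ take a π) C
    new-accepted = All.tabulate (λ j i → Unique-++⇒disjoint (take a π) (subst Unique (sym (take++drop≡id a π)) uπ) i
                                           (Any-resp-⊆ (drop⁺-⊆ a (take-⊆ b π)) j))

  sigma≡pairwise : ∀ {n} R → sigma n R π ≡ take (q n R 1) π ++ concat (pairwise freshBlock (R ++ n ∷ []))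
  sigma≡pairwise {n} R = cong (λ bs → take (q n R 1) π ++ concat bs)
    (trans (sym (map-∘ (upTo (length R))))
      (pairwise-at freshBlock (R ++ n ∷ []) (length R) (sym (trans (length-++ R) (+-comm (length R) 1)))))

  -- The first carrel follows the empty prefix, whose maxL is 0, so it is its own valley.
  valleys-from-0 : ∀ {n} t T′ → Unique π → CutsTo n (0 ∷ t ∷ T′) → Ascending (take t π) →
    take t π ++ concat (pairwise freshBlock (t ∷ T′)) ≡ concat (valleys (0 ∷ t ∷ T′))
  valleys-from-0 t T′ uπ (_ , cuts) t↗ = cong₂ _++_ (sym (valley-0 t↗))
    (cong concat (pairwise-cong (t ∷ T′) (λ a≤b → cong (valley _) (fresh-entries uπ a≤b)) cuts))

  sigma≡concat-valleys : ∀ {n} R → Unique π → CutsTo n (qseq n R) → All (Linked _<_) (carrels n R π) →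
    sigma n R π ≡ concat (valleys (qseq n R))
  sigma≡concat-valleys {n} []      uπ cuts (t↗ ∷ _) =
    trans (sigma≡pairwise []) (valleys-from-0 n [] uπ cuts (strict⇒ascending t↗))
  sigma≡concat-valleys {n} (r ∷ R) uπ cuts (t↗ ∷ _) =
    trans (sigma≡pairwise (r ∷ R)) (valleys-from-0 r (R ++ n ∷ []) uπ cuts (strict⇒ascending t↗))

  R312Avoiding⇒across : ∀ {n} R → length π ≡ n → R312Avoiding n R π → Linked Avoids312Across (qseq n R)
  R312Avoiding⇒across {n} R |π| avoid = Linked-from-at (qseq n R) across-at
    where
    inner : ∀ h → 1 ≤ h → h + 1 ≤ length R → Avoids312Across (q n R h) (q n R (suc h))
    inner h 1≤h h+1≤r m∈ y∈ z∈ yz zm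
      with ∈-slice⇒at π 0 (q n R h) m∈ | ∈-slice⇒at π (q n R h) (q n R (suc h)) y∈
         | ⊆-at π (q n R (suc h)) (from∈ z∈)
    ... | i , 0<i , i≤ , refl | j , j> , j≤ , refl | k , k> , k≤ , refl , _ =
      avoid (h , i , j , k , 1≤h , h+1≤r , 0<i , i≤ , j> , j≤ , k> , subst (k ≤_) |π| k≤ , yz , zm)
    -- The first pair of cuts has an empty prefix and the last pair an empty suffix.
    across-at : ∀ h → suc h < length (qseq n R) → Avoids312Across (q n R h) (q n R (suc h))
    across-at zero    _  ()
    across-at (suc h) lt with suc h + 1 ≤? length R
    ... | yes h+1≤r = inner (suc h) (s≤s z≤n) h+1≤r
    ... | no  h+1≰r = λ _ _ z∈ _ _ → nothing-after-last (subst (λ c → _ ∈ drop c π) last-cut z∈)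
      where
      h≡r : suc h ≡ length R
      h≡r = ≤-antisym (≤-pred (subst (suc (suc h) ≤_) (trans (length-++ R) (+-comm (length R) 1)) (≤-pred lt)))
                      (subst (length R ≤_) (+-comm h 1) (≤-pred (≰⇒> h+1≰r)))
      last-cut : q n R (suc (suc h)) ≡ n
      last-cut rewrite h≡r = at-last R
      nothing-after-last : ∀ {z} → z ∈ drop n π → ⊥
      nothing-after-last z∈ rewrite drop-all n π (≤-reflexive |π|) with () ← z∈

  module _ {n} (π↭[n] : IsPerm n π) (qs : List ℕ) (cuts : CutsTo n (0 ∷ qs)) where

    private
      |π| : length π ≡ n
      |π| = IsPerm⇒length π↭[n]

    concat-valleys-↭ : concat (valleys (0 ∷ qs)) ↭ π
    concat-valleys-↭ = subst (concat (valleys (0 ∷ qs)) ↭_) (concat-carrelsFrom π 0 qs |π| cuts)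
      (↭-concat⁺ (valleys-↭ (0 ∷ qs)))

    concat-valleys-avoids : Linked Avoids312Across (0 ∷ qs) → Avoids312 n (concat (valleys (0 ∷ qs)))
    concat-valleys-avoids across =
      subst (λ k → Avoids312 k (concat (valleys (0 ∷ qs)))) (trans (↭-length concat-valleys-↭) |π|)
        (SubAvoids312⇒Avoids312 _ (SubAvoids312-valleys 0 qs cuts across [] (λ ()) (λ ())))

    proj-concat-valleys : All (Linked _<_) (carrelsFrom (0 ∷ qs) π) →
      concat (map sort (carrelsFrom (0 ∷ qs) (concat (valleys (0 ∷ qs))))) ≡ π
    proj-concat-valleys carrels↗ = begin
      concat (map sort (carrelsFrom (0 ∷ qs) (concat (valleys (0 ∷ qs)))))
        ≡⟨ cong (λ Xs → concat (map sort Xs)) (carrelsFrom-++concat 0 qs [] tiles refl) ⟩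
      concat (map sort (valleys (0 ∷ qs)))
        ≡⟨ cong concat (sort-valleys (0 ∷ qs) carrels↗) ⟩
      concat (carrelsFrom (0 ∷ qs) π)
        ≡⟨ concat-carrelsFrom π 0 qs |π| cuts ⟩
      π ∎
      where
      open ≡-Reasoning
      tiles : Tiles (0 ∷ qs) (valleys (0 ∷ qs))
      tiles = Tiles-↭ (0 ∷ qs) (valleys-↭ (0 ∷ qs)) (Tiles-carrelsFrom π 0 qs |π| cuts)

    concat-valleys-≼ : ∀ σ′ → IsPerm n σ′ → Avoids312 n σ′ →
      concat (map sort (carrelsFrom (0 ∷ qs) σ′)) ≡ π →
      concat (valleys (0 ∷ qs)) ≼ σ′
    concat-valleys-≼ σ′ σ′↭[n] avσ′ proj≡π = subst (concat (valleys (0 ∷ qs)) ≼_) σ′≡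
      (≼-concat (valleys-≼ 0 qs cuts [] (subst SubAvoids312 (sym σ′≡) sub-avσ′) sorted-carrels))
      where
      |σ′| : length σ′ ≡ n
      |σ′| = IsPerm⇒length σ′↭[n]
      sub-avσ′ : SubAvoids312 σ′
      sub-avσ′ = Avoids312⇒SubAvoids312 σ′ (subst (λ k → Avoids312 k σ′) (sym |σ′|) avσ′)
      σ′≡ : concat (carrelsFrom (0 ∷ qs) σ′) ≡ σ′
      σ′≡ = concat-carrelsFrom σ′ 0 qs |σ′| cuts
      sorted-carrels : map sort (carrelsFrom (0 ∷ qs) σ′) ≡ carrelsFrom (0 ∷ qs) π
      sorted-carrels = trans (sym (carrels-proj σ′ qs |σ′| cuts)) (cong (carrelsFrom (0 ∷ qs)) proj≡π)

proposition7p1 : (n : ℕ) → 1 ≤ n → (R : List ℕ) → ValidR n R →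
    (π : List ℕ) → IsRPerm n R π → R312Avoiding n R π →
    (IsPerm n (sigma n R π) × Avoids312 n (sigma n R π) × proj n R (sigma n R π) ≡ π)
    × ((σ' : List ℕ) → IsPerm n σ' → Avoids312 n σ' → proj n R σ' ≡ π →
        inv (sigma n R π) ≤ inv σ' × (inv σ' ≡ inv (sigma n R π) → σ' ≡ sigma n R π))
proposition7p1 n _ R validR π (π↭[n] , carrels↗) avoidR
  rewrite Valleys.sigma≡concat-valleys π R (IsPerm⇒Unique π↭[n]) (ValidR⇒CutsTo n R validR) carrels↗ =
  ( ↭-trans (concat-valleys-↭ π↭[n] qs cuts) π↭[n]
  , concat-valleys-avoids π↭[n] qs cuts (R312Avoiding⇒across R (IsPerm⇒length π↭[n]) avoidR)
  , proj-concat-valleys π↭[n] qs cuts carrels↗ )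
  , λ σ′ σ′↭[n] avσ′ proj≡π → proj₂ (concat-valleys-≼ π↭[n] qs cuts σ′ σ′↭[n] avσ′ proj≡π)
  where
  open Valleys π
  qs : List ℕ
  qs = R ++ n ∷ []
  cuts : CutsTo n (0 ∷ qs)
  cuts = ValidR⇒CutsTo n R validR
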